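{- Let $A=\{a_1\le\dots\le a_n\}$ be a sorted multiset of positive integers and $p$ an integer with $1\le p\le n-k+1$; let $Q=\sum_{i=1}^pa_i$, $q=\max\{i\mid a_i\le Q\}$ and $x=n-q$. If $x>k-1$, then it is not the case that $p$ is perfect for $A$ and the $k$-PART$_R$ instance $(A,p)$ has an optimal solution satisfying properties (1) and (2) below: (1) every set $S_i$ containing only elements $j\le q$ satisfies $\Sigma(S_i,A)<2Q$; (2) every element $j>q$ is contained in a singleton set of the solution.
   Context: $k\ge2$ is a fixed integer, $[n]=\{1,\dots,n\}$, $\Sigma(S,A)=\sum_{i\in S}a_i$. For pairwise disjoint $S_1,\dots,S_k\subseteq[n]$, with $M=\max_i\Sigma(S_i,A)$, $m=\min_i\Sigma(S_i,A)$, the ratio $\mathcal{R}(S_1,\dots,S_k,A)$ is $M/m$ if $m>0$ and $+\infty$ otherwise. $k$-PART: find pairwise disjoint $S_1,\dots,S_k\subseteq[n]$ with $\bigcup_iS_i=[n]$ minimizing $\mathcal{R}$. $k$-PART$_R$ on $(A,p)$: the same with the additional constraints $\max(S_1)=p$ and $\max(S_i)>p$ for $1<i\le k$. $p$ is perfect for $A$ if the optimal ratio of the $k$-PART$_R$ instance $(A,p)$ equals the optimal ratio of the $k$-PART instance $A$. -}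

module Defs where

open import Data.Nat using (ℕ; zero; suc; _+_; _*_; _∸_; _≤_; _<_; _⊔_; _⊓_; _≤ᵇ_)
open import Data.Nat.Properties using ()
open import Data.Fin using (Fin; zero; suc; toℕ; _≟_)
open import Data.List using (List; map; foldr; allFin)
open import Data.Nat.ListAction using (sum)
open import Data.Bool using (Bool; true; false; if_then_else_)
open import Data.Integer using (+_)
open import Data.Rational using (ℚ; _/_) renaming (_≤_ to _≤ℚ_)
open import Data.Unit using (⊤)
open import Data.Empty using (⊥)
open import Data.Product using (Σ; ∃; _×_; _,_)
open import Relation.Nullary using (¬_; does)
open import Relation.Binary.PropositionalEquality using (_≡_)

-- Conventions: element j ∈ [n] (1-based) is represented by (i : Fin n) with j = toℕ i + 1.
-- The multiset A = {a_1 ≤ … ≤ a_n} is a function a : Fin n → ℕ, a_j = a (index j-1).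
-- A family of pairwise disjoint sets S_1,…,S_k with union [n] is exactly an
-- assignment σ : Fin n → Fin k (S_i = σ⁻¹(i); S_1 corresponds to index zero).

sumFin : (n : ℕ) → (Fin n → ℕ) → ℕ
sumFin n f = sum (map f (allFin n))

-- maximum over Fin k (0 as default, harmless for naturals)
maxFin : (k : ℕ) → (Fin k → ℕ) → ℕ
maxFin k g = foldr _⊔_ 0 (map g (allFin k))

-- minimum over Fin k (value at k = 0 irrelevant since k ≥ 2)
minFin : (k : ℕ) → (Fin k → ℕ) → ℕ
minFin zero g = 0
minFin (suc zero) g = g zero
minFin (suc (suc k)) g = g zero ⊓ minFin (suc k) (λ i → g (suc i))

data ℚ∞ : Set where
  fin : ℚ → ℚ∞
  ∞   : ℚ∞

_≤∞_ : ℚ∞ → ℚ∞ → Set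
fin x ≤∞ fin y = x ≤ℚ y
fin x ≤∞ ∞     = ⊤
∞     ≤∞ fin y = ⊥
∞     ≤∞ ∞     = ⊤

ratio : ℕ → ℕ → ℚ∞
ratio M zero    = ∞
ratio M (suc m) = fin ((+ M) / suc m)

ΣS : (n k : ℕ) → (Fin n → ℕ) → (Fin n → Fin k) → Fin k → ℕ
ΣS n k a σ i = sumFin n (λ j → if does (σ j ≟ i) then a j else 0)

ℛ : (n k : ℕ) → (Fin n → ℕ) → (Fin n → Fin k) → ℚ∞
ℛ n k a σ = ratio (maxFin k (ΣS n k a σ)) (minFin k (ΣS n k a σ))

FeasibleR : (n k : ℕ) → ℕ → (Fin n → Fin k) → Set
FeasibleR n zero p σ = ⊥
FeasibleR n (suc k) p σ =
  ((∃ λ j → σ j ≡ zero × toℕ j + 1 ≡ p) × (∀ j → σ j ≡ zero → toℕ j + 1 ≤ p))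
  × (∀ (i : Fin k) → ∃ λ j → σ j ≡ suc i × p < toℕ j + 1)

OptPart : (n k : ℕ) → (Fin n → ℕ) → (Fin n → Fin k) → Set
OptPart n k a σ = ∀ (τ : Fin n → Fin k) → ℛ n k a σ ≤∞ ℛ n k a τ

OptR : (n k : ℕ) → (Fin n → ℕ) → ℕ → (Fin n → Fin k) → Set
OptR n k a p σ =
  FeasibleR n k p σ × (∀ (τ : Fin n → Fin k) → FeasibleR n k p τ → ℛ n k a σ ≤∞ ℛ n k a τ)

Perfect : (n k : ℕ) → (Fin n → ℕ) → ℕ → Set
Perfect n k a p = ∃ λ σ → ∃ λ τ → OptR n k a p σ × OptPart n k a τ × ℛ n k a σ ≡ ℛ n k a τ

Qof : (n : ℕ) → (Fin n → ℕ) → ℕ → ℕ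
Qof n a p = sumFin n (λ j → if toℕ j + 1 ≤ᵇ p then a j else 0)

-- q = max { i | a_i ≤ Q }  (the set is nonempty when p ≥ 1, so default 0 is harmless)
qof : (n : ℕ) → (Fin n → ℕ) → ℕ → ℕ
qof n a p = maxFin n (λ j → if a j ≤ᵇ Qof n a p then toℕ j + 1 else 0)

Prop1 : (n k : ℕ) → (Fin n → ℕ) → ℕ → (Fin n → Fin k) → Set
Prop1 n k a p σ = ∀ (i : Fin k) → (∀ j → σ j ≡ i → toℕ j + 1 ≤ qof n a p)
                   → ΣS n k a σ i < 2 * Qof n a p

Prop2 : (n k : ℕ) → (Fin n → ℕ) → ℕ → (Fin n → Fin k) → Set
Prop2 n k a p σ = ∀ j → qof n a p < toℕ j + 1 → ∀ j' → σ j' ≡ σ j → j' ≡ j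

-- By property (2) each of the elements q+1, …, n lies alone in its set; as
-- n − q ≥ k there are at least k of them, and they sit in k distinct sets.
-- Together with element q (note q ≥ 1, since a₁ ≤ Q) these are k + 1 elements
-- in pairwise distinct sets, which is impossible with only k sets.
module Submission where

open import Defs
open import Data.Nat using (ℕ; zero; suc; _+_; _∸_; _≤_; _<_; z≤n; s≤s; _≤ᵇ_)
open import Data.Nat.Properties
open import Data.Fin using (Fin; toℕ; zero; suc; _↑ʳ_; inject≤)
open import Data.Fin.Properties using (toℕ-↑ʳ; toℕ-inject≤; ↑ʳ-injective; inject≤-injective; injective⇒≤)
open import Data.Bool using (true; if_then_else_)
open import Data.Product using (∃; _×_; _,_)
open import Function using (_∘_; Injective)
open import Relation.Nullary using (¬_)
open import Relation.Binary.PropositionalEquality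

private
  variable
    k m n : ℕ

≤ᵇ-select : ∀ {A : Set} {m n} (x y : A) → m ≤ n → (if m ≤ᵇ n then x else y) ≡ x
≤ᵇ-select {m = m} {n} x y m≤n with m ≤ᵇ n | ≤⇒≤ᵇ m≤n
... | true | _ = refl

qof-positive : (a : Fin (suc n) → ℕ) (p : ℕ) → 1 ≤ p → 1 ≤ qof (suc n) a p
qof-positive {n} a p 1≤p = begin
  1                                                 ≡⟨ sym (≤ᵇ-select 1 0 a₁≤Q) ⟩
  (if a zero ≤ᵇ Qof (suc n) a p then 1 else 0)      ≤⟨ m≤m⊔n _ _ ⟩
  qof (suc n) a p                                   ∎
  where
  open ≤-Reasoning
  a₁≤Q : a zero ≤ Qof (suc n) a p
  a₁≤Q = begin
    a zero                             ≡⟨ sym (≤ᵇ-select (a zero) 0 1≤p) ⟩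
    (if 1 ≤ᵇ p then a zero else 0)     ≤⟨ m≤m+n _ _ ⟩
    Qof (suc n) a p                    ∎

0<∸⇒< : ∀ q → 0 < n ∸ q → q < n
0<∸⇒< q lt = m∸n≢0⇒n<m (m>n⇒m∸n≢0 lt)

pred<∸⇒+≤ : ∀ q → k ∸ 1 < n ∸ q → q + k ≤ n
pred<∸⇒+≤ {zero}  q lt = ≤-trans (≤-reflexive (+-identityʳ q)) (<⇒≤ (0<∸⇒< q lt))
pred<∸⇒+≤ {suc k} {n} q lt = begin
  q + suc k        ≤⟨ +-monoʳ-≤ q lt ⟩
  q + (n ∸ q)      ≡⟨ m+[n∸m]≡n (<⇒≤ (0<∸⇒< q (≤-trans (s≤s z≤n) lt))) ⟩
  n                ∎
  where open ≤-Reasoning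

window : ∀ m → m + k ≤ n → Fin k → Fin n
window m h i = inject≤ (m ↑ʳ i) h

toℕ-window : ∀ m (h : m + k ≤ n) i → toℕ (window m h i) ≡ m + toℕ i
toℕ-window m h i = trans (toℕ-inject≤ (m ↑ʳ i) h) (toℕ-↑ʳ m i)

window-injective : ∀ m (h : m + k ≤ n) → Injective _≡_ _≡_ (window m h)
window-injective m h {i} {j} eq = ↑ʳ-injective m i j (inject≤-injective h h _ _ eq)

Singleton : (Fin n → Fin k) → Fin n → Set
Singleton σ j = ∀ j' → σ j' ≡ σ j → j' ≡ j

∘-injective-on-singletons : (σ : Fin n → Fin k) {f : Fin (suc m) → Fin n}
  → Injective _≡_ _≡_ f → (∀ i → Singleton σ (f (suc i))) → Injective _≡_ _≡_ (σ ∘ f)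
∘-injective-on-singletons _ _ _ {zero} {zero} _ = refl
∘-injective-on-singletons σ {f} f-inj single {i}     {suc j} eq = f-inj (single j (f i) eq)
∘-injective-on-singletons σ {f} f-inj single {suc i} {j}     eq = f-inj (sym (single i (f j) (sym eq)))

-- Indices q′, …, q′ + k (the elements q, …, q + k) are k + 1 positions whose last k are singletons.
singletons-above-exhaust : (σ : Fin n → Fin k) (q : ℕ) → 1 ≤ q → q + k ≤ n
  → ¬ (∀ j → q < toℕ j + 1 → Singleton σ j)
singletons-above-exhaust {n} {k} σ (suc q′) _ q+k≤n single =
  1+n≰n (injective⇒≤ (∘-injective-on-singletons σ (window-injective q′ h) single-window))
  where
  h : q′ + suc k ≤ n
  h = ≤-trans (≤-reflexive (+-suc q′ k)) q+k≤n
  single-window : ∀ i → Singleton σ (window q′ h (suc i))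
  single-window i = single _ (begin-strict
    suc q′                            ≤⟨ s≤s (m≤m+n q′ (toℕ i)) ⟩
    suc (q′ + toℕ i)                  ≡⟨ sym (+-suc q′ (toℕ i)) ⟩
    q′ + suc (toℕ i)                  ≡⟨ sym (toℕ-window q′ h (suc i)) ⟩
    toℕ (window q′ h (suc i))         <⟨ m<m+n _ (s≤s z≤n) ⟩
    toℕ (window q′ h (suc i)) + 1     ∎)
    where open ≤-Reasoning

lemma19 : (k : ℕ) → 2 ≤ k → (n : ℕ) → (a : Fin n → ℕ)
          → (∀ i → 0 < a i)
          → (∀ i j → toℕ i ≤ toℕ j → a i ≤ a j)
          → (p : ℕ) → 1 ≤ p → p ≤ n + 1 ∸ k
          → k ∸ 1 < n ∸ qof n a p
          → ¬ (Perfect n k a p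
               × ∃ λ σ → OptR n k a p σ × Prop1 n k a p σ × Prop2 n k a p σ)
lemma19 k _ zero    a _ _ p _ _ ()
lemma19 k _ (suc n) a _ _ p 1≤p _ x>k-1 (_ , σ , _ , _ , prop2) =
  singletons-above-exhaust σ (qof (suc n) a p) (qof-positive a p 1≤p)
    (pred<∸⇒+≤ (qof (suc n) a p) x>k-1) prop2
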